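{- Let $n,m,l\ge 0$ and suppose the sequent $\Psi\Rightarrow R(\bar n,\bar m,\bar l)$ is valid. Then $l=n+2^m$, and for every Herbrand sequent $\Gamma_1,\Gamma_2\Rightarrow R(\bar n,\bar m,\bar l)$ of $\Psi\Rightarrow R(\bar n,\bar m,\bar l)$ we have $\{R(\bar i,0,S(\bar i)) : n\le i<n+2^m\}\subseteq\Gamma_1$. In particular $|\Gamma_1|\ge 2^m$.
   Context: Consider the first-order language (without equality) with a constant $0$, a unary function symbol $S$ and a ternary relation symbol $R$; $\bar n$ abbreviates $S^n(0)$. Let $\mathrm{Hyp}_1\equiv\forall x\,R(x,0,S(x))$ and $\mathrm{Hyp}_2\equiv\forall y\forall x\forall z\forall z_1(R(y,x,z)\land R(z,x,z_1)\to R(y,S(x),z_1))$, and $\Psi=\{\mathrm{Hyp}_1,\mathrm{Hyp}_2\}$. A sequent $\Gamma\Rightarrow\Delta$ is valid if $\bigwedge\Gamma\to\bigvee\Delta$ is logically valid. A Herbrand sequent of $\Psi\Rightarrow F$ ($F$ quantifier-free) is a valid sequent $\Gamma_1,\Gamma_2\Rightarrow F$ where $\Gamma_1$ is a finite set of substitution instances $R(u,0,S(u))$ of the matrix of $\mathrm{Hyp}_1$ and $\Gamma_2$ is a finite set of substitution instances $R(u,v,w)\land R(w,v,w')\to R(u,S(v),w')$ of the matrix of $\mathrm{Hyp}_2$ ($u,v,w,w'$ arbitrary terms). -}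

module Defs where

open import Data.Nat using (ℕ; zero; suc; _≟_)
open import Data.Bool using (Bool; true)
open import Data.Product using (_×_; Σ; ∃; _,_)
open import Data.List using (List; []; _∷_; _++_)
open import Data.List.Relation.Unary.All using (All)
open import Relation.Nullary using (yes; no)
open import Relation.Binary.PropositionalEquality using (_≡_)

data Term : Set where
  var : ℕ → Term
  `0  : Term
  `S  : Term → Term

-- Formulas: enough connectives for Ψ and for the Herbrand instances.
data Formula : Set where
  Rel  : Term → Term → Term → Formula
  _∧'_ : Formula → Formula → Formula
  _⇒'_ : Formula → Formula → Formula
  ∀'   : ℕ → Formula → Formula

infixr 6 _∧'_
infixr 5 _⇒'_

num : ℕ → Term
num zero    = `0
num (suc n) = `S (num n)

record Structure : Set₁ where
  field
    Dom  : Set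
    zeroᴹ : Dom
    sucᴹ  : Dom → Dom
    Rᴹ    : Dom → Dom → Dom → Bool

module _ (M : Structure) where
  open Structure M

  Assignment : Set
  Assignment = ℕ → Dom

  update : Assignment → ℕ → Dom → Assignment
  update ρ x d y with x ≟ y
  ... | yes _ = d
  ... | no  _ = ρ y

  evalT : Assignment → Term → Dom
  evalT ρ (var x) = ρ x
  evalT ρ `0      = zeroᴹ
  evalT ρ (`S t)  = sucᴹ (evalT ρ t)

  Sat : Assignment → Formula → Set
  Sat ρ (Rel a b c) = Rᴹ (evalT ρ a) (evalT ρ b) (evalT ρ c) ≡ true
  Sat ρ (φ ∧' ψ)    = Sat ρ φ × Sat ρ ψ
  Sat ρ (φ ⇒' ψ)    = Sat ρ φ → Sat ρ ψ
  Sat ρ (∀' x φ)    = (d : Dom) → Sat (update ρ x d) φ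

Valid : List Formula → Formula → Set₁
Valid Γ F = (M : Structure) (ρ : Assignment M) → All (Sat M ρ) Γ → Sat M ρ F

Hyp₁ : Formula
Hyp₁ = ∀' 0 (Rel (var 0) `0 (`S (var 0)))

-- Hyp₂ ≡ ∀y∀x∀z∀z₁ (R(y,x,z) ∧ R(z,x,z₁) → R(y,S x,z₁))
-- variables: y = 0, x = 1, z = 2, z₁ = 3
Hyp₂ : Formula
Hyp₂ = ∀' 0 (∀' 1 (∀' 2 (∀' 3
         ((Rel (var 0) (var 1) (var 2) ∧' Rel (var 2) (var 1) (var 3))
            ⇒' Rel (var 0) (`S (var 1)) (var 3)))))

Ψ : List Formula
Ψ = Hyp₁ ∷ Hyp₂ ∷ []

inst₁ : Term → Formula
inst₁ u = Rel u `0 (`S u)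

inst₂ : Term → Term → Term → Term → Formula
inst₂ u v w w' = (Rel u v w ∧' Rel w v w') ⇒' Rel u (`S v) w'

IsInst₁ : Formula → Set
IsInst₁ φ = ∃ λ u → φ ≡ inst₁ u

IsInst₂ : Formula → Set
IsInst₂ φ = Σ Term λ u → Σ Term λ v → Σ Term λ w → Σ Term λ w' → φ ≡ inst₂ u v w w'

HerbrandSequent : List Formula → List Formula → Formula → Set₁
HerbrandSequent Γ₁ Γ₂ F = All IsInst₁ Γ₁ × All IsInst₂ Γ₂ × Valid (Γ₁ ++ Γ₂) F

-- In the intended model R(a,b,c) means c = a + 2^b, which fixes l. For the Herbrand bound,
-- punch a hole at i: let R(a,b,c) hold only when c = a + 2^b and i ∉ [a, c). Intervals
-- [a,c), [c,d) missing i glue to one missing i, so every Hyp₂ instance stays true, and the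
-- only Hyp₁ instance that fails is R(ī,0,S ī). If that instance were missing from Γ₁, the
-- model would satisfy Γ₁, Γ₂ but falsify R(n̄,m̄,l̄) for n ≤ i < n + 2^m.
module Submission where

open import Defs
open import Data.Nat using (ℕ; zero; suc; _+_; _^_; _≤_; _<_; _≟_; _<?_; _≤?_)
open import Data.Nat.Properties using (+-assoc; +-comm; +-identityʳ; +-cancelˡ-≡; <-cmp; ≤⇒≯; m≤m+n; +-monoʳ-<)
open import Data.Bool using (Bool; true; false)
open import Data.Maybe using (Maybe; just; nothing)
import Data.Maybe as Maybe
import Data.Maybe.Properties as Maybeₚ
open import Data.Unit using (⊤; tt)
open import Data.Product using (_×_; _,_; uncurry)
open import Data.Sum using (_⊎_; inj₁; inj₂)
open import Data.Fin using (Fin; toℕ)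
open import Data.Fin.Properties using (injective⇒≤; toℕ<n; toℕ-injective)
open import Data.List using (List; []; _∷_; length; lookup)
open import Data.List.Membership.Propositional using (_∈_)
open import Data.List.Relation.Unary.All as All using (All; []; _∷_)
open import Data.List.Relation.Unary.All.Properties using (++⁺)
open import Data.List.Relation.Unary.Any using (here; there; index)
open import Data.List.Relation.Unary.Any.Properties using (lookup-index)
open import Data.List.Relation.Unary.Unique.Propositional using (Unique)
open import Function using (Injective; _∘_)
open import Relation.Nullary using (Dec; yes; no; does; proof; ¬_; contradiction)
open import Relation.Nullary.Reflects using (Reflects; invert)
open import Relation.Nullary.Decidable using (dec-true; map′; _×-dec_; _⊎-dec_)
open import Relation.Binary.Definitions using (tri<; tri≈; tri>)
open import Relation.Binary.PropositionalEquality using (_≡_; _≢_; refl; sym; trans; cong; subst; module ≡-Reasoning)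

Hyp₁Holds : Structure → Set
Hyp₁Holds M = ∀ d → Rᴹ d zeroᴹ (sucᴹ d) ≡ true
  where open Structure M

Hyp₂Holds : Structure → Set
Hyp₂Holds M = ∀ y x z z₁ → Rᴹ y x z ≡ true → Rᴹ z x z₁ ≡ true → Rᴹ y (sucᴹ x) z₁ ≡ true
  where open Structure M

module _ {M : Structure} (ρ : Assignment M) where

  sat-Hyp₂ : Hyp₂Holds M → Sat M ρ Hyp₂
  sat-Hyp₂ hyp₂ y x z z₁ (yxz , zxz₁) = hyp₂ y x z z₁ yxz zxz₁

  sat-inst₂ : Hyp₂Holds M → ∀ u v w w' → Sat M ρ (inst₂ u v w w')
  sat-inst₂ hyp₂ u v w w' (uvw , wvw') = hyp₂ _ _ _ _ uvw wvw'

  sat-Inst₂ : Hyp₂Holds M → ∀ {φ} → IsInst₂ φ → Sat M ρ φ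
  sat-Inst₂ hyp₂ (u , v , w , w' , refl) = sat-inst₂ hyp₂ u v w w'

  sat-Ψ : Hyp₁Holds M → Hyp₂Holds M → All (Sat M ρ) Ψ
  sat-Ψ hyp₁ hyp₂ = hyp₁ ∷ sat-Hyp₂ hyp₂ ∷ []

Clear : Maybe ℕ → ℕ → ℕ → Set
Clear nothing  a c = ⊤
Clear (just i) a c = i < a ⊎ c ≤ i

clear? : ∀ h a c → Dec (Clear h a c)
clear? nothing  a c = yes tt
clear? (just i) a c = (i <? a) ⊎-dec (c ≤? i)

Clear-trans : ∀ h {a c d} → Clear h a c → Clear h c d → Clear h a d
Clear-trans nothing  _          _          = tt
Clear-trans (just i) (inj₁ i<a) _          = inj₁ i<a
Clear-trans (just i) (inj₂ c≤i) (inj₁ i<c) = contradiction i<c (≤⇒≯ c≤i)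
Clear-trans (just i) (inj₂ _)   (inj₂ d≤i) = inj₂ d≤i

Clear-suc : ∀ {i a} → i ≢ a → Clear (just i) a (suc a)
Clear-suc {i} {a} i≢a with <-cmp i a
... | tri< i<a _ _ = inj₁ i<a
... | tri≈ _ i≡a _ = contradiction i≡a i≢a
... | tri> _ _ a<i = inj₂ a<i

record Related (h : Maybe ℕ) (a b c : ℕ) : Set where
  constructor related
  field
    sum≡  : c ≡ a + 2 ^ b
    clear : Clear h a c

related? : ∀ h a b c → Dec (Related h a b c)
related? h a b c =
  map′ (uncurry related) (λ r → Related.sum≡ r , Related.clear r) ((c ≟ a + 2 ^ b) ×-dec clear? h a c)

Related-trans : ∀ h {a b c d} → Related h a b c → Related h c b d → Related h a (suc b) d
Related-trans h {a} {b} {c} {d} (related c≡ ac) (related d≡ cd) =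
  related d≡a+2^[1+b] (Clear-trans h ac cd)
  where
  open ≡-Reasoning
  d≡a+2^[1+b] : d ≡ a + 2 ^ suc b
  d≡a+2^[1+b] = begin
    d                   ≡⟨ d≡ ⟩
    c + 2 ^ b           ≡⟨ cong (_+ 2 ^ b) c≡ ⟩
    a + 2 ^ b + 2 ^ b   ≡⟨ +-assoc a (2 ^ b) (2 ^ b) ⟩
    a + (2 ^ b + 2 ^ b) ≡⟨ cong (λ x → a + (2 ^ b + x)) (sym (+-identityʳ (2 ^ b))) ⟩
    a + 2 ^ suc b       ∎

-- nothing is a junk element: it interprets every term containing a variable, and R holds
-- vacuously from it.
R : Maybe ℕ → Maybe ℕ → Maybe ℕ → Maybe ℕ → Bool
R h nothing  _        _        = true
R h (just a) (just b) (just c) = does (related? h a b c)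
R h (just _) _        _        = false

powerModel : Maybe ℕ → Structure
powerModel h = record
  { Dom = Maybe ℕ ; zeroᴹ = just 0 ; sucᴹ = Maybe.map suc ; Rᴹ = R h }

R-intro : ∀ h a b c → Related h a b c → R h (just a) (just b) (just c) ≡ true
R-intro h a b c = dec-true (related? h a b c)

R-elim : ∀ h a b c → R h (just a) (just b) (just c) ≡ true → Related h a b c
R-elim h a b c holds = invert (subst (Reflects _) holds (proof (related? h a b c)))

R-zero-suc : ∀ h y → (∀ {a} → y ≡ just a → Clear h a (suc a)) →
  R h y (just 0) (Maybe.map suc y) ≡ true
R-zero-suc h nothing  _     = refl
R-zero-suc h (just a) clear = R-intro h a 0 (suc a) (related (sym (+-comm a 1)) (clear refl))

powerModel-Hyp₁ : Hyp₁Holds (powerModel nothing)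
powerModel-Hyp₁ y = R-zero-suc nothing y (λ _ → tt)

powerModel-Hyp₂ : ∀ h → Hyp₂Holds (powerModel h)
powerModel-Hyp₂ h nothing  _        _        _        _   _   = refl
powerModel-Hyp₂ h (just a) (just b) (just c) (just d) abc cbd =
  R-intro h a (suc b) d (Related-trans h (R-elim h a b c abc) (R-elim h c b d cbd))
powerModel-Hyp₂ h (just a) nothing  _        _        ()  _
powerModel-Hyp₂ h (just a) (just b) nothing  _        ()  _
powerModel-Hyp₂ h (just a) (just b) (just c) nothing  _   ()

junk : ℕ → Maybe ℕ
junk _ = nothing

evalT-num : ∀ h (ρ : Assignment (powerModel h)) n → evalT (powerModel h) ρ (num n) ≡ just n
evalT-num h ρ zero    = refl
evalT-num h ρ (suc n) = cong (Maybe.map suc) (evalT-num h ρ n)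

evalT-junk-just : ∀ h u {j} → evalT (powerModel h) junk u ≡ just j → u ≡ num j
evalT-junk-just h `0     refl = refl
evalT-junk-just h (`S u) e with evalT (powerModel h) junk u in eu
... | just k with refl ← e = cong `S (evalT-junk-just h u eu)

sat-num⇒Related : ∀ h (ρ : Assignment (powerModel h)) n m l →
  Sat (powerModel h) ρ (Rel (num n) (num m) (num l)) → Related h n m l
sat-num⇒Related h ρ n m l holds
  rewrite evalT-num h ρ n | evalT-num h ρ m | evalT-num h ρ l = R-elim h n m l holds

valid-Ψ⇒≡+2^ : ∀ n m l → Valid Ψ (Rel (num n) (num m) (num l)) → l ≡ n + 2 ^ m
valid-Ψ⇒≡+2^ n m l valid = Related.sum≡ (sat-num⇒Related nothing junk n m l
  (valid M junk (sat-Ψ junk powerModel-Hyp₁ (powerModel-Hyp₂ nothing))))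
  where M = powerModel nothing

inst₁-hole-or-sat : ∀ i {φ} → IsInst₁ φ → inst₁ (num i) ≡ φ ⊎ Sat (powerModel (just i)) junk φ
inst₁-hole-or-sat i (u , refl) with Maybeₚ.≡-dec _≟_ (evalT M junk u) (just i)
  where M = powerModel (just i)
... | yes u↦i = inj₁ (cong inst₁ (sym (evalT-junk-just (just i) u u↦i)))
... | no u↦̸i  = inj₂ (R-zero-suc (just i) _ λ u↦a → Clear-suc λ { refl → u↦̸i u↦a })

∈⊎All : ∀ {A : Set} {P : A → Set} {x xs} → All (λ y → x ≡ y ⊎ P y) xs → x ∈ xs ⊎ All P xs
∈⊎All []              = inj₂ []
∈⊎All (inj₁ x≡y ∷ _)  = inj₁ (here x≡y)
∈⊎All (inj₂ py ∷ pxs) with ∈⊎All pxs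
... | inj₁ x∈xs = inj₁ (there x∈xs)
... | inj₂ Pxs  = inj₂ (py ∷ Pxs)

Clear-∉ : ∀ {i a c} → a ≤ i → i < c → ¬ Clear (just i) a c
Clear-∉ a≤i i<c (inj₁ i<a) = ≤⇒≯ a≤i i<a
Clear-∉ a≤i i<c (inj₂ c≤i) = ≤⇒≯ c≤i i<c

herbrand-∋-inst₁ : ∀ {n m l Γ₁ Γ₂} → HerbrandSequent Γ₁ Γ₂ (Rel (num n) (num m) (num l)) →
  ∀ {i} → n ≤ i → i < l → inst₁ (num i) ∈ Γ₁
herbrand-∋-inst₁ {n} {m} {l} (inst₁s , inst₂s , valid) {i} n≤i i<l
  with ∈⊎All (All.map (inst₁-hole-or-sat i) inst₁s)
... | inj₁ i∈Γ₁  = i∈Γ₁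
... | inj₂ satΓ₁ = contradiction (Related.clear (sat-num⇒Related (just i) junk n m l
  (valid M junk (++⁺ satΓ₁ (All.map (sat-Inst₂ junk (powerModel-Hyp₂ (just i))) inst₂s)))))
  (Clear-∉ n≤i i<l)
  where M = powerModel (just i)

injective-members⇒≤length : ∀ {A : Set} {k} {xs : List A} {f : Fin k → A} →
  Injective _≡_ _≡_ f → (∀ a → f a ∈ xs) → k ≤ length xs
injective-members⇒≤length {xs = xs} f-inj f∈xs = injective⇒≤ {f = index ∘ f∈xs} λ {a} {b} ia≡ib →
  f-inj (trans (lookup-index (f∈xs a)) (trans (cong (lookup xs) ia≡ib) (sym (lookup-index (f∈xs b)))))

num-injective : ∀ {x y} → num x ≡ num y → x ≡ y
num-injective {zero}  {zero}  _    = refl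
num-injective {suc x} {suc y} S≡S = cong suc (num-injective (`S-injective S≡S))
  where
  `S-injective : ∀ {t u} → `S t ≡ `S u → t ≡ u
  `S-injective refl = refl

inst₁-injective : ∀ {t u} → inst₁ t ≡ inst₁ u → t ≡ u
inst₁-injective refl = refl

interval-members⇒≤length : ∀ {Γ} n k → (∀ j → n ≤ j → j < n + k → inst₁ (num j) ∈ Γ) → k ≤ length Γ
interval-members⇒≤length n k mem = injective-members⇒≤length
  {f = λ a → inst₁ (num (n + toℕ a))}
  (toℕ-injective ∘ +-cancelˡ-≡ n _ _ ∘ num-injective ∘ inst₁-injective)
  (λ a → mem (n + toℕ a) (m≤m+n n (toℕ a)) (+-monoʳ-< n (toℕ<n a)))

mainTheorem10 : (n m l : ℕ) → Valid Ψ (Rel (num n) (num m) (num l)) →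
    (l ≡ n + 2 ^ m) ×
    ((Γ₁ Γ₂ : List Formula) → HerbrandSequent Γ₁ Γ₂ (Rel (num n) (num m) (num l)) →
    ((i : ℕ) → n ≤ i → i < n + 2 ^ m → inst₁ (num i) ∈ Γ₁) ×
    (Unique Γ₁ → 2 ^ m ≤ length Γ₁))
mainTheorem10 n m l valid = l≡n+2^m , λ Γ₁ Γ₂ herbrand →
  covered herbrand , λ _ → interval-members⇒≤length n (2 ^ m) (covered herbrand)
  where
  l≡n+2^m : l ≡ n + 2 ^ m
  l≡n+2^m = valid-Ψ⇒≡+2^ n m l valid

  covered : ∀ {Γ₁ Γ₂} → HerbrandSequent Γ₁ Γ₂ (Rel (num n) (num m) (num l)) →
    ∀ i → n ≤ i → i < n + 2 ^ m → inst₁ (num i) ∈ Γ₁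
  covered herbrand i n≤i i<n+2^m =
    herbrand-∋-inst₁ {m = m} herbrand n≤i (subst (i <_) (sym l≡n+2^m) i<n+2^m)
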